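{- Let $G$ be a connected unicyclic graph such that every vertex belonging to the (unique) cycle of $G$ has degree greater than two. Then $\mathrm{pd}(G)\le n_1(G)-\rho(G)+1$.
   Context: All graphs are finite, simple and connected; $d(u,v)$ denotes the distance between vertices $u,v$, and for a set $P$ of vertices $d(v,P)=\min_{u\in P} d(v,u)$. A unicyclic graph is a connected graph containing exactly one cycle. For an ordered partition $\Pi=\{P_1,\dots,P_t\}$ of the vertex set $V$ of $G$, the partition representation of $v\in V$ is $r(v|\Pi)=(d(v,P_1),\dots,d(v,P_t))$; $\Pi$ is a resolving partition if $r(u|\Pi)\ne r(v|\Pi)$ for all distinct $u,v\in V$. The partition dimension $\mathrm{pd}(G)$ is the minimum number of sets in a resolving partition of $G$. A pendant vertex is a vertex of degree one; $n_1(G)$ is the number of pendant vertices of $G$. A support vertex is a vertex adjacent to a pendant vertex; $\rho(G)$ is the number of support vertices of $G$ adjacent to more than one pendant vertex. -}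

module Defs where

open import Data.Nat using (ℕ; zero; suc; _+_; _∸_; _≤_; _<_)
open import Data.Fin using (Fin; zero; suc; inject₁; fromℕ)
open import Data.Bool using (Bool; true; false)
open import Data.List using (List; length; filter)
open import Data.List using () renaming (allFin to allFinL)
open import Data.Product using (Σ; ∃; _×_; _,_)
open import Data.Sum using (_⊎_)
open import Data.Empty using (⊥)
open import Relation.Nullary using (¬_; Dec)
open import Relation.Binary.PropositionalEquality using (_≡_; _≢_)
open import Function.Definitions using (Injective)
open import Relation.Nullary.Decidable using (does)
open import Data.Bool using (T)
open import Data.Nat using (_≤?_)

record Graph (n : ℕ) : Set where
  field
    adj     : Fin n → Fin n → Bool
    symm    : ∀ u v → adj u v ≡ adj v u
    irrefl  : ∀ v → adj v v ≡ false

open Graph public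

Adj : ∀ {n} → Graph n → Fin n → Fin n → Set
Adj G u v = adj G u v ≡ true

data Walk {n : ℕ} (G : Graph n) : Fin n → Fin n → ℕ → Set where
  here : ∀ {v} → Walk G v v zero
  step : ∀ {u w v k} → Adj G u w → Walk G w v k → Walk G u v (suc k)

Connected : ∀ {n} → Graph n → Set
Connected {n} G = ∀ (u v : Fin n) → ∃ λ k → Walk G u v k

DistIs : ∀ {n} → Graph n → Fin n → Fin n → ℕ → Set
DistIs {n} G u v k = Walk G u v k × (∀ m → Walk G u v m → k ≤ m)

neighbours : ∀ {n} → Graph n → Fin n → List (Fin n)
neighbours {n} G v = filter (λ u → adj G v u ≡? true) (allFinL n)
  where
  open import Data.Bool.Properties using () renaming (_≟_ to _≡?_)

degree : ∀ {n} → Graph n → Fin n → ℕ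
degree G v = length (neighbours G v)

isPendant? : ∀ {n} (G : Graph n) (v : Fin n) → Dec (degree G v ≡ 1)
isPendant? G v = degree G v ≟ 1
  where open import Data.Nat using (_≟_)

n₁ : ∀ {n} → Graph n → ℕ
n₁ {n} G = length (filter (isPendant? G) (allFinL n))

pendantNeighbours : ∀ {n} → Graph n → Fin n → ℕ
pendantNeighbours G v = length (filter (isPendant? G) (neighbours G v))

ρ : ∀ {n} → Graph n → ℕ
ρ {n} G = length (filter (λ v → 2 ≤? pendantNeighbours G v) (allFinL n))

-- A cycle: a cyclic sequence c₀,…,c_{k-1} (k = m+3 ≥ 3) of distinct vertices,
-- consecutive ones (including c_{k-1}, c₀) adjacent.
record Cycle {n : ℕ} (G : Graph n) : Set where
  field
    m       : ℕ
    vert    : Fin (suc (suc (suc m))) → Fin n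
    inj     : Injective _≡_ _≡_ vert
    consec  : ∀ (i : Fin (suc (suc m))) → Adj G (vert (inject₁ i)) (vert (suc i))
    closing : Adj G (vert (fromℕ (suc (suc m)))) (vert zero)

open Cycle public

UEdge : ∀ {n} → Fin n → Fin n → Fin n → Fin n → Set
UEdge a b x y = (a ≡ x × b ≡ y) ⊎ (a ≡ y × b ≡ x)

CycleEdge : ∀ {n} {G : Graph n} → Cycle G → Fin n → Fin n → Set
CycleEdge C a b =
  (∃ λ i → UEdge a b (vert C (inject₁ i)) (vert C (suc i)))
  ⊎ UEdge a b (vert C (fromℕ (suc (suc (m C))))) (vert C zero)

-- Two cycles are the same subgraph iff they have the same edge set.
SameCycle : ∀ {n} {G : Graph n} → Cycle G → Cycle G → Set
SameCycle {n} C C' = ∀ (a b : Fin n) →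
  (CycleEdge C a b → CycleEdge C' a b) × (CycleEdge C' a b → CycleEdge C a b)

OnCycle : ∀ {n} {G : Graph n} → Cycle G → Fin n → Set
OnCycle C v = ∃ λ i → vert C i ≡ v

Unicyclic : ∀ {n} → Graph n → Set
Unicyclic G = Connected G × Cycle G × (∀ (C C' : Cycle G) → SameCycle C C')

-- Ordered partition into t nonempty classes P_i = { v | f v ≡ i }.
-- d(v, P_i) = k
SetDistIs : ∀ {n t} → Graph n → (Fin n → Fin t) → Fin n → Fin t → ℕ → Set
SetDistIs {n} G f v i k =
  (∃ λ u → f u ≡ i × DistIs G v u k) ×
  (∀ (u : Fin n) (j : ℕ) → f u ≡ i → DistIs G v u j → k ≤ j)

Resolving : ∀ {n t} → Graph n → (Fin n → Fin t) → Set
Resolving {n} {t} G f = ∀ (u v : Fin n) → u ≢ v →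
  ∃ λ (i : Fin t) → ∃ λ k₁ → ∃ λ k₂ →
    SetDistIs G f u i k₁ × SetDistIs G f v i k₂ × k₁ ≢ k₂

record ResolvingPartition {n : ℕ} (G : Graph n) (t : ℕ) : Set where
  field
    cls       : Fin n → Fin t
    nonempty  : ∀ (i : Fin t) → ∃ λ v → cls v ≡ i
    resolving : Resolving G cls

PdAtMost : ∀ {n} → Graph n → ℕ → Set
PdAtMost G b = ∃ λ t → t ≤ b × ResolvingPartition G t

-- Drop, at every support vertex with at least two pendant neighbours, its least-numbered
-- pendant neighbour, and keep all other pendant vertices: the kept pendant vertices form
-- singleton classes and everything else one more class, at most n₁ − ρ + 1 classes in all.
-- For u ≠ v there is a leaf ℓ with d(u, ℓ) < d(v, ℓ): walking away from v as far as possible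
-- ends at a local maximum x ≠ v of d(·, v), and x is a leaf: besides a neighbour closer to v,
-- any neighbour no farther from v closes a cycle through x, whose degree is then at least
-- three, so a third neighbour would put a third edge of the unique cycle at x.  A dropped
-- leaf has a kept sibling at the same distance from every other vertex, and two dropped
-- leaves hang off different supports, so the kept sibling of one of them separates them.

module Submission where

open import Defs
open import Data.Nat using (ℕ; zero; suc; _+_; _∸_; _<_; _≤_; z≤n; s≤s; _≤?_)
open import Data.Nat.Properties
open import Data.Product using (Σ; ∃; _×_; _,_; proj₁; proj₂)
open import Data.Sum using (_⊎_; inj₁; inj₂)
import Data.Sum as Sum
open import Data.Unit using (⊤; tt)
open import Function using (_∘_; case_of_)
open import Data.Empty using (⊥-elim)
open import Relation.Nullary using (¬_; Dec; yes; no)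
open import Relation.Nullary.Decidable using (decidable-stable; _×-dec_; _→-dec_)
open import Relation.Unary using (Decidable)
open import Relation.Unary.Properties using (∁?)
open import Relation.Binary.Definitions using (DecidableEquality)
open import Relation.Binary.PropositionalEquality
open import Data.Fin using (Fin; toℕ)
import Data.Fin.Relation.Unary.Top as Top
import Data.Fin as Fin
import Data.Fin.Properties as Fin
open import Data.Bool using (true)
import Data.Bool.Properties as Bool
open import Data.List using (List; []; _∷_; length; filter; lookup; map; _++_; allFin)
import Data.List.Properties as List
open import Data.List.Membership.Propositional using (_∈_; _∉_; find; lose)
open import Data.List.Membership.Propositional.Properties
  using (∈-map⁺; ∈-filter⁺; ∈-filter⁻; ∈-allFin; ∈-∃++; ∈-++⁻; ∈-++⁺ˡ; ∈-++⁺ʳ; ∈-lookup)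
open import Data.List.Relation.Binary.Subset.Propositional using (_⊆_)
open import Data.List.Relation.Unary.Any using (here; there; any?; index)
open import Data.List.Relation.Unary.Any.Properties using (lookup-index)
open import Data.List.Relation.Unary.All using ([]; _∷_) renaming (lookup to All-lookup)
open import Data.List.Relation.Unary.All.Properties using (all-filter)
open import Data.List.Relation.Unary.AllPairs using ([]; _∷_)
open import Data.List.Extrema.Nat
  using (argmax; argmin; argmax-all; argmin-all; f[xs]≤f[argmax]; f[argmin]≤f[xs])
open import Data.List.Relation.Unary.Unique.Propositional using (Unique)
import Data.List.Relation.Unary.Unique.Propositional.Properties as Unique

Least : (ℕ → Set) → ℕ → Set
Least P m = P m × (∀ j → P j → m ≤ j)

module _ {P : ℕ → Set} (P? : Decidable P) where

  private
    search : ∀ i k → (∀ {j} → j < i → ¬ P j) → P (i + k) → ∃ (Least P)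
    search i k below pik with P? i
    ... | yes pi = i , pi , λ _ pj → ≮⇒≥ (λ j<i → below j<i pj)
    search i zero    below pik | no ¬pi = ⊥-elim (¬pi (subst P (+-identityʳ i) pik))
    search i (suc k) below pik | no ¬pi = search (suc i) k below′ (subst P (+-suc i k) pik)
      where
      below′ : ∀ {j} → j < suc i → ¬ P j
      below′ j<1+i with m<1+n⇒m<n∨m≡n j<1+i
      ... | inj₁ j<i = below j<i
      ... | inj₂ refl = ¬pi

  least-witness : ∀ {k} → P k → ∃ (Least P)
  least-witness {k} = search 0 k (λ ())

module _ {A : Set} where

  Unique-⊆⇒length-≤ : ∀ {xs ys : List A} → Unique xs → xs ⊆ ys → length xs ≤ length ys
  Unique-⊆⇒length-≤ {[]} _ _ = z≤n
  Unique-⊆⇒length-≤ {x ∷ xs} {ys} (x∉xs ∷ u) xs⊆ys with ∈-∃++ (xs⊆ys (here refl))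
  ... | ys₁ , ys₂ , refl = begin
    suc (length xs)                 ≤⟨ s≤s (Unique-⊆⇒length-≤ u xs⊆ys₁ys₂) ⟩
    suc (length (ys₁ ++ ys₂))       ≡⟨ cong suc (List.length-++ ys₁) ⟩
    suc (length ys₁ + length ys₂)   ≡⟨ sym (+-suc (length ys₁) (length ys₂)) ⟩
    length ys₁ + length (x ∷ ys₂)   ≡⟨ sym (List.length-++ ys₁) ⟩
    length (ys₁ ++ x ∷ ys₂)         ∎
    where
    open ≤-Reasoning
    xs⊆ys₁ys₂ : xs ⊆ ys₁ ++ ys₂
    xs⊆ys₁ys₂ {y} y∈xs with ∈-++⁻ ys₁ (xs⊆ys (there y∈xs))
    ... | inj₁ y∈ys₁          = ∈-++⁺ˡ y∈ys₁
    ... | inj₂ (here refl)    = ⊥-elim (All-lookup x∉xs y∈xs refl)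
    ... | inj₂ (there y∈ys₂)  = ∈-++⁺ʳ ys₁ y∈ys₂

  lookup-injective : ∀ {xs : List A} → Unique xs → ∀ {i j} → lookup xs i ≡ lookup xs j → i ≡ j
  lookup-injective {_ ∷ _} _ {Fin.zero} {Fin.zero} _ = refl
  lookup-injective {_ ∷ _} (x∉xs ∷ _) {Fin.zero} {Fin.suc j} eq = ⊥-elim (All-lookup x∉xs (∈-lookup j) eq)
  lookup-injective {_ ∷ _} (x∉xs ∷ _) {Fin.suc i} {Fin.zero} eq = ⊥-elim (All-lookup x∉xs (∈-lookup i) (sym eq))
  lookup-injective {_ ∷ _} (_ ∷ u) {Fin.suc i} {Fin.suc j} eq = cong Fin.suc (lookup-injective u eq)

  length-filter+length-filter-∁ : ∀ {P : A → Set} (P? : Decidable P) xs →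
    length xs ≡ length (filter P? xs) + length (filter (∁? P?) xs)
  length-filter+length-filter-∁ P? [] = refl
  length-filter+length-filter-∁ P? (x ∷ xs) with P? x
  ... | yes _ = cong suc (length-filter+length-filter-∁ P? xs)
  ... | no _  = trans (cong suc (length-filter+length-filter-∁ P? xs)) (sym (+-suc _ _))

module _ {k : ℕ} {S : Fin k → Set} (S? : Decidable S) (f : Fin k → ℕ) where

  private
    candidates : List (Fin k)
    candidates = filter S? (allFin k)

    ∈-candidates : ∀ {y} → S y → y ∈ candidates
    ∈-candidates {y} = ∈-filter⁺ S? (∈-allFin y)

  maximiser : ∀ {x₀} → S x₀ → ∃ λ x → S x × (∀ y → S y → f y ≤ f x)
  maximiser {x₀} sx₀ =
    argmax f x₀ candidates ,
    argmax-all f sx₀ (all-filter S? (allFin k)) ,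
    λ y sy → All-lookup (f[xs]≤f[argmax] x₀ candidates) (∈-candidates sy)

  minimiser : ∀ {x₀} → S x₀ → ∃ λ x → S x × (∀ y → S y → f x ≤ f y)
  minimiser {x₀} sx₀ =
    argmin f x₀ candidates ,
    argmin-all f sx₀ (all-filter S? (allFin k)) ,
    λ y sy → All-lookup (f[argmin]≤f[xs] x₀ candidates) (∈-candidates sy)

module _ {A : Set} (_≟_ : DecidableEquality A) where
  open import Data.List.Membership.DecPropositional _≟_ using (_∈?_; _∉?_)

  Unique⇒∃∉ : ∀ {xs ys : List A} → Unique xs → length ys < length xs → ∃ λ y → y ∈ xs × y ∉ ys
  Unique⇒∃∉ {xs} {ys} u ys<xs with any? (_∉? ys) xs
  ... | yes some∉ = find some∉
  ... | no ¬some∉ = ⊥-elim (<⇒≱ ys<xs (Unique-⊆⇒length-≤ u xs⊆ys))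
    where
    xs⊆ys : xs ⊆ ys
    xs⊆ys {y} y∈xs = decidable-stable (y ∈? ys) (λ y∉ys → ¬some∉ (lose y∈xs y∉ys))

module Neighbourhood {n : ℕ} (G : Graph n) where

  adj-sym : ∀ {u v} → Adj G u v → Adj G v u
  adj-sym {u} {v} uv = trans (symm G v u) uv

  adj⇒≢ : ∀ {u v} → Adj G u v → u ≢ v
  adj⇒≢ {u} uu refl with trans (sym uu) (irrefl G u)
  ... | ()

  adj? : ∀ u v → Dec (Adj G u v)
  adj? u v = adj G u v Bool.≟ true

  ∈-neighbours⁺ : ∀ {x y} → Adj G x y → y ∈ neighbours G x
  ∈-neighbours⁺ {x} {y} = ∈-filter⁺ (adj? x) (∈-allFin y)

  ∈-neighbours⁻ : ∀ {x y} → y ∈ neighbours G x → Adj G x y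
  ∈-neighbours⁻ {x} y∈ = proj₂ (∈-filter⁻ (adj? x) {xs = allFin n} y∈)

  neighbours-unique : ∀ x → Unique (neighbours G x)
  neighbours-unique x = Unique.filter⁺ (adj? x) (Unique.allFin⁺ n)

  Leaf : Fin n → Set
  Leaf x = degree G x ≡ 1

  leaf-adj-unique : ∀ {x s y} → Leaf x → Adj G x s → Adj G x y → y ≡ s
  leaf-adj-unique {x} {s} {y} leaf xs xy with y Fin.≟ s
  ... | yes y≡s = y≡s
  ... | no y≢s =
    ⊥-elim (<-irrefl refl (subst (2 ≤_) leaf (Unique-⊆⇒length-≤ ((y≢s ∷ []) ∷ [] ∷ []) ys⊆)))
    where
    ys⊆ : y ∷ s ∷ [] ⊆ neighbours G x
    ys⊆ (here refl)         = ∈-neighbours⁺ xy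
    ys⊆ (there (here refl)) = ∈-neighbours⁺ xs

  degree≡1 : ∀ {x p} → Adj G x p → (∀ {y} → Adj G x y → y ≡ p) → Leaf x
  degree≡1 {x} {p} xp only = ≤-antisym
    (Unique-⊆⇒length-≤ {ys = p ∷ []} (neighbours-unique x) (λ y∈ → here (only (∈-neighbours⁻ y∈))))
    (Unique-⊆⇒length-≤ {xs = p ∷ []} ([] ∷ []) λ { (here refl) → ∈-neighbours⁺ xp })

  third-neighbour : ∀ {x} → 2 < degree G x → ∀ p q → ∃ λ z → Adj G x z × z ≢ p × z ≢ q
  third-neighbour {x} 2<deg p q with Unique⇒∃∉ Fin._≟_ {ys = p ∷ q ∷ []} (neighbours-unique x) 2<deg
  ... | z , z∈ , z∉ =
    z , ∈-neighbours⁻ z∈ , (λ z≡p → z∉ (here z≡p)) , (λ z≡q → z∉ (there (here z≡q)))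

module Walks {n : ℕ} (G : Graph n) where
  open Neighbourhood G

  snoc : ∀ {u v w k} → Walk G u v k → Adj G v w → Walk G u w (suc k)
  snoc here         vw = step vw here
  snoc (step uu′ p) vw = step uu′ (snoc p vw)

  reverse : ∀ {u v k} → Walk G u v k → Walk G v u k
  reverse here        = here
  reverse (step uw p) = snoc (reverse p) (adj-sym uw)

  walk-zero : ∀ {u v} → Walk G u v 0 → u ≡ v
  walk-zero here = refl

  walk? : ∀ k u v → Dec (Walk G u v k)
  walk? zero u v with u Fin.≟ v
  ... | yes refl = yes here
  ... | no u≢v   = no λ p → u≢v (walk-zero p)
  walk? (suc k) u v with Fin.any? (λ w → adj? u w ×-dec walk? k w v)
  ... | yes (w , uw , p) = yes (step uw p)
  ... | no ¬step         = no λ { (step uw p) → ¬step (_ , uw , p) }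

  OnWalk : ∀ {u v k} → Fin n → Walk G u v k → Set
  OnWalk {u} e here       = e ≡ u
  OnWalk {u} e (step _ p) = e ≡ u ⊎ OnWalk e p

  Simple : ∀ {u v k} → Walk G u v k → Set
  Simple here             = ⊤
  Simple {u} (step _ p)   = ¬ OnWalk u p × Simple p

  onWalk-snoc : ∀ {u v w k e} (p : Walk G u v k) (vw : Adj G v w) →
                OnWalk e (snoc p vw) → OnWalk e p ⊎ e ≡ w
  onWalk-snoc here        vw (inj₁ e≡v) = inj₁ e≡v
  onWalk-snoc here        vw (inj₂ e≡w) = inj₂ e≡w
  onWalk-snoc (step _ p)  vw (inj₁ e≡u) = inj₁ (inj₁ e≡u)
  onWalk-snoc (step _ p)  vw (inj₂ e∈)  = Sum.map₁ inj₂ (onWalk-snoc p vw e∈)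

  simple-snoc : ∀ {u v w k} (p : Walk G u v k) (vw : Adj G v w) →
                Simple p → ¬ OnWalk w p → Simple (snoc p vw)
  simple-snoc here        vw _            w∉p = (λ v≡w → w∉p (sym v≡w)) , tt
  simple-snoc (step _ p)  vw (u∉p , sp)   w∉p = u∉p′ , simple-snoc p vw sp (w∉p ∘ inj₂)
    where
    u∉p′ : ¬ OnWalk _ (snoc p vw)
    u∉p′ u∈ with onWalk-snoc p vw u∈
    ... | inj₁ u∈p = u∉p u∈p
    ... | inj₂ u≡w = w∉p (inj₁ (sym u≡w))

  onWalk-reverse : ∀ {u v k e} (p : Walk G u v k) → OnWalk e (reverse p) → OnWalk e p
  onWalk-reverse here        e∈ = e∈
  onWalk-reverse (step uw p) e∈ with onWalk-snoc (reverse p) (adj-sym uw) e∈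
  ... | inj₁ e∈p = inj₂ (onWalk-reverse p e∈p)
  ... | inj₂ e≡u = inj₁ e≡u

  simple-reverse : ∀ {u v k} (p : Walk G u v k) → Simple p → Simple (reverse p)
  simple-reverse here        _          = tt
  simple-reverse (step uw p) (u∉p , sp) =
    simple-snoc (reverse p) (adj-sym uw) (simple-reverse p sp) (u∉p ∘ onWalk-reverse p)

  vertex : ∀ {u v k} → Walk G u v k → Fin (suc k) → Fin n
  vertex {u} _          Fin.zero    = u
  vertex     (step _ p) (Fin.suc i) = vertex p i

  vertex-zero : ∀ {u v k} (p : Walk G u v k) → vertex p Fin.zero ≡ u
  vertex-zero here       = refl
  vertex-zero (step _ p) = refl

  vertex-last : ∀ {u v k} (p : Walk G u v k) → vertex p (Fin.fromℕ k) ≡ v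
  vertex-last here       = refl
  vertex-last (step _ p) = vertex-last p

  vertex-onWalk : ∀ {u v k} (p : Walk G u v k) i → OnWalk (vertex p i) p
  vertex-onWalk here       Fin.zero    = refl
  vertex-onWalk (step _ p) Fin.zero    = inj₁ refl
  vertex-onWalk (step _ p) (Fin.suc i) = inj₂ (vertex-onWalk p i)

  vertex-injective : ∀ {u v k} (p : Walk G u v k) → Simple p → ∀ {i j} → vertex p i ≡ vertex p j → i ≡ j
  vertex-injective here       _          {Fin.zero}  {Fin.zero}  _  = refl
  vertex-injective (step _ p) _          {Fin.zero}  {Fin.zero}  _  = refl
  vertex-injective (step _ p) (u∉p , _)  {Fin.zero}  {Fin.suc j} eq =
    ⊥-elim (u∉p (subst (λ e → OnWalk e p) (sym eq) (vertex-onWalk p j)))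
  vertex-injective (step _ p) (u∉p , _)  {Fin.suc i} {Fin.zero}  eq =
    ⊥-elim (u∉p (subst (λ e → OnWalk e p) eq (vertex-onWalk p i)))
  vertex-injective (step _ p) (_ , sp)   {Fin.suc i} {Fin.suc j} eq = cong Fin.suc (vertex-injective p sp eq)

  vertex-adj : ∀ {u v k} (p : Walk G u v k) (i : Fin k) →
               Adj G (vertex p (Fin.inject₁ i)) (vertex p (Fin.suc i))
  vertex-adj (step uw p) Fin.zero    = subst (Adj G _) (sym (vertex-zero p)) uw
  vertex-adj (step _ p)  (Fin.suc i) = vertex-adj p i

module Distance {n : ℕ} (G : Graph n) (connected : Connected G) where
  open Neighbourhood G
  open Walks G

  -- abstract: an unfolding dist would block inference of its arguments by unification
  private abstract
    shortest : ∀ u v → ∃ (DistIs G u v)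
    shortest u v = least-witness (λ k → walk? k u v) (proj₂ (connected u v))

  dist : Fin n → Fin n → ℕ
  dist u v = proj₁ (shortest u v)

  dist-DistIs : ∀ u v → DistIs G u v (dist u v)
  dist-DistIs u v = proj₂ (shortest u v)

  dist-walk : ∀ u v → Walk G u v (dist u v)
  dist-walk u v = proj₁ (dist-DistIs u v)

  dist-minimal : ∀ {u v k} → Walk G u v k → dist u v ≤ k
  dist-minimal {u} {v} p = proj₂ (dist-DistIs u v) _ p

  dist-sym : ∀ u v → dist u v ≡ dist v u
  dist-sym u v = ≤-antisym (dist-minimal (reverse (dist-walk v u))) (dist-minimal (reverse (dist-walk u v)))

  dist-refl : ∀ u → dist u u ≡ 0
  dist-refl u = n≤0⇒n≡0 (dist-minimal here)

  dist≡0⇒≡ : ∀ {u v} → dist u v ≡ 0 → u ≡ v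
  dist≡0⇒≡ {u} {v} eq = walk-zero (subst (Walk G u v) eq (dist-walk u v))

  dist-adjˡ : ∀ {u w} v → Adj G u w → dist u v ≤ suc (dist w v)
  dist-adjˡ v uw = dist-minimal (step uw (dist-walk _ v))

  dist-adjʳ : ∀ u {x y} → Adj G x y → dist u y ≤ suc (dist u x)
  dist-adjʳ u xy = dist-minimal (snoc (dist-walk u _) xy)

  adj⇒dist≡1 : ∀ {u v} → Adj G u v → dist u v ≡ 1
  adj⇒dist≡1 {u} uv = ≤-antisym
    (subst (λ d → dist u _ ≤ suc d) (dist-refl u) (dist-adjʳ u uv))
    (n≢0⇒n>0 (adj⇒≢ uv ∘ dist≡0⇒≡))

  closer-neighbour : ∀ {u v} → u ≢ v → ∃ λ p → Adj G u p × dist u v ≡ suc (dist p v)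
  closer-neighbour {u} {v} u≢v = go (dist-walk u v) refl
    where
    go : ∀ {k} → Walk G u v k → k ≡ dist u v → ∃ λ p → Adj G u p × dist u v ≡ suc (dist p v)
    go here        _  = ⊥-elim (u≢v refl)
    go (step up p) eq = _ , up , ≤-antisym (dist-adjˡ v up) (subst (_ ≤_) eq (s≤s (dist-minimal p)))

  leaf-dist : ∀ {ℓ s w} → Leaf ℓ → Adj G ℓ s → w ≢ ℓ → dist w ℓ ≡ suc (dist w s)
  leaf-dist {ℓ} {s} {w} leaf ℓs w≢ℓ with closer-neighbour (w≢ℓ ∘ sym)
  ... | p , ℓp , ℓw with leaf-adj-unique leaf ℓs ℓp
  ...   | refl = begin
    dist w ℓ       ≡⟨ dist-sym w ℓ ⟩
    dist ℓ w       ≡⟨ ℓw ⟩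
    suc (dist p w) ≡⟨ cong suc (dist-sym p w) ⟩
    suc (dist w p) ∎
    where open ≡-Reasoning

module Cycles {n : ℕ} (G : Graph n) where
  open Walks G

  CycleThrough : Fin n → Fin n → Fin n → Set
  CycleThrough x a b = Σ (Cycle G) λ C → OnCycle C x × CycleEdge C x a × CycleEdge C x b

  close-path : ∀ {x a b k} (xa : Adj G x a) (p : Walk G a b (suc k)) → Simple (step xa p) →
               Adj G b x → CycleThrough x a b
  close-path {x} {k = k} xa p simple bx = C , (Fin.zero , refl) , edge-xa , edge-xb
    where
    C : Cycle G
    C = record
      { m       = k
      ; vert    = vertex (step xa p)
      ; inj     = vertex-injective (step xa p) simple
      ; consec  = vertex-adj (step xa p)
      ; closing = subst (λ e → Adj G e x) (sym (vertex-last p)) bx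
      }

    edge-xa : CycleEdge C x _
    edge-xa = inj₁ (Fin.zero , inj₁ (refl , sym (vertex-zero p)))

    edge-xb : CycleEdge C x _
    edge-xb = inj₂ (inj₂ (refl , sym (vertex-last p)))

CyclicSucc : ∀ {k} → Fin (suc k) → Fin (suc k) → Set
CyclicSucc {k} i j = toℕ j ≡ suc (toℕ i) ⊎ (toℕ i ≡ k × toℕ j ≡ 0)

cyclicSucc-functional : ∀ {k} {i j j′ : Fin (suc k)} → CyclicSucc i j → CyclicSucc i j′ → j ≡ j′
cyclicSucc-functional (inj₁ j≡1+i)        (inj₁ j′≡1+i)      = Fin.toℕ-injective (trans j≡1+i (sym j′≡1+i))
cyclicSucc-functional {j = j} (inj₁ j≡1+i) (inj₂ (i≡k , _))  =
  ⊥-elim (<-irrefl refl (subst (_< _) (trans j≡1+i (cong suc i≡k)) (Fin.toℕ<n j)))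
cyclicSucc-functional {j′ = j′} (inj₂ (i≡k , _)) (inj₁ j′≡1+i) =
  ⊥-elim (<-irrefl refl (subst (_< _) (trans j′≡1+i (cong suc i≡k)) (Fin.toℕ<n j′)))
cyclicSucc-functional (inj₂ (_ , j≡0))    (inj₂ (_ , j′≡0))  = Fin.toℕ-injective (trans j≡0 (sym j′≡0))

cyclicSucc-injective : ∀ {k} {i i′ j : Fin (suc k)} → CyclicSucc i j → CyclicSucc i′ j → i ≡ i′
cyclicSucc-injective (inj₁ j≡1+i) (inj₁ j≡1+i′)    = Fin.toℕ-injective (suc-injective (trans (sym j≡1+i) j≡1+i′))
cyclicSucc-injective (inj₁ j≡1+i) (inj₂ (_ , j≡0)) with trans (sym j≡1+i) j≡0
... | ()
cyclicSucc-injective (inj₂ (_ , j≡0)) (inj₁ j≡1+i′) with trans (sym j≡1+i′) j≡0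
... | ()
cyclicSucc-injective (inj₂ (i≡k , _)) (inj₂ (i′≡k , _)) = Fin.toℕ-injective (trans i≡k (sym i′≡k))

pigeonhole-⊎ : ∀ {A : Set} {P Q : A → Set} →
               (∀ {y z} → P y → P z → y ≡ z) → (∀ {y z} → Q y → Q z → y ≡ z) →
               ∀ {a b c} → P a ⊎ Q a → P b ⊎ Q b → P c ⊎ Q c → a ≡ b ⊎ a ≡ c ⊎ b ≡ c
pigeonhole-⊎ P! Q! (inj₁ pa) (inj₁ pb) _         = inj₁ (P! pa pb)
pigeonhole-⊎ P! Q! (inj₂ qa) (inj₂ qb) _         = inj₁ (Q! qa qb)
pigeonhole-⊎ P! Q! (inj₁ pa) (inj₂ _)  (inj₁ pc) = inj₂ (inj₁ (P! pa pc))
pigeonhole-⊎ P! Q! (inj₁ _)  (inj₂ qb) (inj₂ qc) = inj₂ (inj₂ (Q! qb qc))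
pigeonhole-⊎ P! Q! (inj₂ qa) (inj₁ _)  (inj₂ qc) = inj₂ (inj₁ (Q! qa qc))
pigeonhole-⊎ P! Q! (inj₂ _)  (inj₁ pb) (inj₁ pc) = inj₂ (inj₂ (P! pb pc))

module _ {n : ℕ} {G : Graph n} (C : Cycle G) where

  private
    K = suc (suc (m C))

    CycleNeighbours : Fin (suc K) → Fin (suc K) → Set
    CycleNeighbours i j = CyclicSucc i j ⊎ CyclicSucc j i

    cycleEdge-indices : ∀ {x a} → CycleEdge C x a →
      ∃ λ i → ∃ λ j → vert C i ≡ x × vert C j ≡ a × CycleNeighbours i j
    cycleEdge-indices (inj₁ (k , inj₁ (x≡ , a≡))) =
      Fin.inject₁ k , Fin.suc k , sym x≡ , sym a≡ , inj₁ (inj₁ (cong suc (sym (Fin.toℕ-inject₁ k))))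
    cycleEdge-indices (inj₁ (k , inj₂ (a≡ , x≡))) =
      Fin.suc k , Fin.inject₁ k , sym a≡ , sym x≡ , inj₂ (inj₁ (cong suc (sym (Fin.toℕ-inject₁ k))))
    cycleEdge-indices (inj₂ (inj₁ (x≡ , a≡))) =
      Fin.fromℕ K , Fin.zero , sym x≡ , sym a≡ , inj₁ (inj₂ (Fin.toℕ-fromℕ K , refl))
    cycleEdge-indices (inj₂ (inj₂ (a≡ , x≡))) =
      Fin.zero , Fin.fromℕ K , sym a≡ , sym x≡ , inj₂ (inj₂ (Fin.toℕ-fromℕ K , refl))

  cycleEdges-at-most-two : ∀ {x a b c} → CycleEdge C x a → CycleEdge C x b → CycleEdge C x c →
                           a ≡ b ⊎ a ≡ c ⊎ b ≡ c
  cycleEdges-at-most-two xa xb xc with cycleEdge-indices xa | cycleEdge-indices xb | cycleEdge-indices xc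
  ... | i , ja , i↦x , ja↦a , i~ja | i′ , jb , i′↦x , jb↦b , i′~jb | i″ , jc , i″↦x , jc↦c , i″~jc
      with inj C (trans i↦x (sym i′↦x)) | inj C (trans i↦x (sym i″↦x))
  ... | refl | refl = Sum.map (image ja↦a jb↦b) (Sum.map (image ja↦a jc↦c) (image jb↦b jc↦c))
        (pigeonhole-⊎ cyclicSucc-functional cyclicSucc-injective i~ja i′~jb i″~jc)
    where
    image : ∀ {j j′ y y′} → vert C j ≡ y → vert C j′ ≡ y′ → j ≡ j′ → y ≡ y′
    image j↦y j′↦y′ refl = trans (sym j↦y) j′↦y′

module DescendingPaths {n : ℕ} (G : Graph n) (connected : Connected G) (r : Fin n) where
  open Neighbourhood G
  open Walks G
  open Distance G connected
  open Cycles G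

  _≼_ : Fin n → Fin n → Set
  e ≼ a = e ≡ a ⊎ dist e r < dist a r

  ≼-lower : ∀ {e p a} → dist p r < dist a r → e ≼ p → e ≼ a
  ≼-lower p<a (inj₁ refl) = inj₂ p<a
  ≼-lower p<a (inj₂ e<p)  = inj₂ (<-trans e<p p<a)

  ⋠ : ∀ {x a} → x ≢ a → dist a r ≤ dist x r → ¬ x ≼ a
  ⋠ x≢a a≤x (inj₁ x≡a) = x≢a x≡a
  ⋠ x≢a a≤x (inj₂ x<a) = <⇒≱ x<a a≤x

  not-root : ∀ {a b} → a ≢ b → dist b r ≤ dist a r → a ≢ r
  not-root {a} {b} a≢b b≤a refl = a≢b (sym (dist≡0⇒≡ (n≤0⇒n≡0 (subst (dist b a ≤_) (dist-refl a) b≤a))))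

  record DescendingPath (a b : Fin n) : Set where
    field
      {len}  : ℕ
      walk   : Walk G a b len
      simple : Simple walk
      below  : ∀ {e} → OnWalk e walk → e ≼ a ⊎ e ≼ b

  descendingPath-sym : ∀ {a b} → DescendingPath a b → DescendingPath b a
  descendingPath-sym P = record
    { walk   = reverse walk
    ; simple = simple-reverse walk simple
    ; below  = Sum.swap ∘ below ∘ onWalk-reverse walk
    }
    where open DescendingPath P

  descend : ∀ {a b} → a ≢ b → dist b r ≤ dist a r →
            (∀ {p} → dist p r < dist a r → DescendingPath p b) → DescendingPath a b
  descend {a} {b} a≢b b≤a rec with closer-neighbour (not-root a≢b b≤a)
  ... | p , ap , ar = record
    { walk   = step ap walk
    ; simple = a∉walk , simple
    ; below  = λ { (inj₁ e≡a) → inj₁ (inj₁ e≡a) ; (inj₂ e∈) → Sum.map₁ (≼-lower p<a) (below e∈) }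
    }
    where
    p<a : dist p r < dist a r
    p<a = ≤-reflexive (sym ar)
    open DescendingPath (rec p<a)
    a∉walk : ¬ OnWalk a walk
    a∉walk a∈ with below a∈
    ... | inj₁ a≼p = ⋠ (adj⇒≢ ap) (<⇒≤ p<a) a≼p
    ... | inj₂ a≼b = ⋠ a≢b b≤a a≼b

  descendingPath : ∀ a b → DescendingPath a b
  descendingPath a b = go _ a b (n<1+n _)
    where
    go : ∀ k a b → dist a r + dist b r < k → DescendingPath a b
    go (suc k) a b bound with a Fin.≟ b
    ... | yes refl = record { walk = here ; simple = tt ; below = λ e≡a → inj₁ (inj₁ e≡a) }
    ... | no a≢b with dist b r ≤? dist a r
    ...   | yes b≤a = descend a≢b b≤a λ p<a →
              go k _ b (<-≤-trans (+-monoˡ-< (dist b r) p<a) (≤-pred bound))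
    ...   | no  b≰a = descendingPath-sym (descend (a≢b ∘ sym) (<⇒≤ (≰⇒> b≰a)) λ q<b →
              go k _ a (<-≤-trans (+-monoˡ-< (dist a r) q<b)
                                  (≤-pred (subst (_< suc k) (+-comm (dist a r) _) bound))))

  cycle-through-lower-neighbours : ∀ {x a b} → Adj G x a → Adj G x b → a ≢ b →
    dist a r ≤ dist x r → dist b r ≤ dist x r → CycleThrough x a b
  cycle-through-lower-neighbours {x} {a} {b} xa xb a≢b a≤x b≤x with descendingPath a b
  ... | record { len = zero ; walk = p } = ⊥-elim (a≢b (walk-zero p))
  ... | record { len = suc _ ; walk = p ; simple = sp ; below = below } =
    close-path xa p (x∉p , sp) (adj-sym xb)
    where
    x∉p : ¬ OnWalk x p
    x∉p x∈ = Sum.[ ⋠ (adj⇒≢ xa) a≤x , ⋠ (adj⇒≢ xb) b≤x ] (below x∈)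

module BranchingUnicyclic {n : ℕ} (G : Graph n) (connected : Connected G)
    (cycle-unique : ∀ (C C′ : Cycle G) → SameCycle C C′)
    (cycle-degree : ∀ (C : Cycle G) v → OnCycle C v → 2 < degree G v) where
  open Neighbourhood G
  open Distance G connected
  open Cycles G

  local-max-leaf : ∀ r x → x ≢ r → (∀ {y} → Adj G x y → dist y r ≤ dist x r) → Leaf x
  local-max-leaf r x x≢r max with closer-neighbour x≢r
  ... | p , xp , xr = degree≡1 xp only-p
    where
    open DescendingPaths G connected r
    p≤x : dist p r ≤ dist x r
    p≤x = <⇒≤ (≤-reflexive (sym xr))
    only-p : ∀ {y} → Adj G x y → y ≡ p
    only-p {y} xy with y Fin.≟ p
    ... | yes y≡p = y≡p
    ... | no  y≢p with cycle-through-lower-neighbours xp xy (y≢p ∘ sym) p≤x (max xy)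
    ...   | C , x∈C , xp∈C , xy∈C with third-neighbour (cycle-degree C x x∈C) p y
    ...     | z , xz , z≢p , z≢y with cycle-through-lower-neighbours xp xz (z≢p ∘ sym) p≤x (max xz)
    ...       | C′ , _ , _ , xz∈C′
                with cycleEdges-at-most-two C xp∈C xy∈C (proj₁ (cycle-unique C′ C x z) xz∈C′)
    ...         | inj₁ p≡y         = ⊥-elim (y≢p (sym p≡y))
    ...         | inj₂ (inj₁ p≡z)  = ⊥-elim (z≢p (sym p≡z))
    ...         | inj₂ (inj₂ y≡z)  = ⊥-elim (z≢y (sym y≡z))

  far-leaf : ∀ {u v} → u ≢ v → ∃ λ ℓ → Leaf ℓ × dist u ℓ < dist v ℓ
  far-leaf {u} {v} u≢v =
    conclude (maximiser (λ x → dist u x + dist u v ≤? dist x v) (λ x → dist x v) beyond-u)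
    where
    -- u lies on a shortest path from v to x; a farthest such x from v is a local maximum.
    Beyond : Fin n → Set
    Beyond x = dist u x + dist u v ≤ dist x v

    beyond-u : Beyond u
    beyond-u = ≤-reflexive (cong (_+ dist u v) (dist-refl u))

    0<uv : 0 < dist u v
    0<uv = n≢0⇒n>0 (u≢v ∘ dist≡0⇒≡)

    conclude : (∃ λ x → Beyond x × ∀ y → Beyond y → dist y v ≤ dist x v) →
               ∃ λ ℓ → Leaf ℓ × dist u ℓ < dist v ℓ
    conclude (x , beyond-x , maximal) = x , local-max-leaf v x x≢v local-max , ux<vx
      where
      x≢v : x ≢ v
      x≢v refl = <⇒≱ 0<uv (subst (dist u v ≤_) (dist-refl x) (≤-trans (m≤n+m _ _) beyond-x))

      local-max : ∀ {y} → Adj G x y → dist y v ≤ dist x v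
      local-max {y} xy = ≮⇒≥ λ x<y →
        <⇒≱ x<y (maximal y (≤-trans (+-monoˡ-≤ (dist u v) (dist-adjʳ u xy)) (≤-trans (s≤s beyond-x) x<y)))

      ux<vx : dist u x < dist v x
      ux<vx = begin-strict
        dist u x              <⟨ m<m+n (dist u x) 0<uv ⟩
        dist u x + dist u v   ≤⟨ beyond-x ⟩
        dist x v              ≡⟨ dist-sym x v ⟩
        dist v x              ∎
        where open ≤-Reasoning

module PendantVertices {n : ℕ} (G : Graph n) where
  open Neighbourhood G

  -- The one dropped pendant neighbour of each support vertex counted by ρ.
  Redundant : Fin n → Set
  Redundant ℓ = ∃ λ s → Adj G ℓ s × Leaf ℓ × 2 ≤ pendantNeighbours G s ×
                        (∀ ℓ′ → Adj G s ℓ′ → Leaf ℓ′ → toℕ ℓ ≤ toℕ ℓ′)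

  redundant? : Decidable Redundant
  redundant? ℓ = Fin.any? λ s →
    adj? ℓ s ×-dec isPendant? G ℓ ×-dec 2 ≤? pendantNeighbours G s ×-dec
    Fin.all? (λ ℓ′ → adj? s ℓ′ →-dec (isPendant? G ℓ′ →-dec toℕ ℓ ≤? toℕ ℓ′))

  Kept : Fin n → Set
  Kept ℓ = Leaf ℓ × ¬ Redundant ℓ

  kept? : Decidable Kept
  kept? ℓ = isPendant? G ℓ ×-dec ∁? redundant? ℓ

  redundant-unique : ∀ {ℓ₁ ℓ₂ s} → Redundant ℓ₁ → Redundant ℓ₂ → Adj G ℓ₁ s → Adj G ℓ₂ s → ℓ₁ ≡ ℓ₂
  redundant-unique (s₁ , ℓ₁s₁ , leaf₁ , _ , least₁) (s₂ , ℓ₂s₂ , leaf₂ , _ , least₂) ℓ₁s ℓ₂s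
    with leaf-adj-unique leaf₁ ℓ₁s ℓ₁s₁ | leaf-adj-unique leaf₂ ℓ₂s ℓ₂s₂
  ... | refl | refl =
    Fin.toℕ-injective (≤-antisym (least₁ _ (adj-sym ℓ₂s) leaf₂) (least₂ _ (adj-sym ℓ₁s) leaf₁))

  pendantNeighbourList : Fin n → List (Fin n)
  pendantNeighbourList s = filter (isPendant? G) (neighbours G s)

  ∈-pendantNeighbourList⁻ : ∀ {s ℓ} → ℓ ∈ pendantNeighbourList s → Adj G s ℓ × Leaf ℓ
  ∈-pendantNeighbourList⁻ {s} ℓ∈ with ∈-filter⁻ (isPendant? G) {xs = neighbours G s} ℓ∈
  ... | ℓ∈N , leaf = ∈-neighbours⁻ ℓ∈N , leaf

  another-pendant-neighbour : ∀ {s} → 2 ≤ pendantNeighbours G s → ∀ ys → length ys < 2 →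
                              ∃ λ ℓ → Adj G s ℓ × Leaf ℓ × ℓ ∉ ys
  another-pendant-neighbour {s} 2≤ ys ys<2 with
    Unique⇒∃∉ Fin._≟_ (Unique.filter⁺ (isPendant? G) (neighbours-unique s)) (<-≤-trans ys<2 2≤)
  ... | ℓ , ℓ∈ , ℓ∉ys with ∈-pendantNeighbourList⁻ ℓ∈
  ...   | sℓ , leaf = ℓ , sℓ , leaf , ℓ∉ys

  kept-sibling : ∀ {ℓ s} → Redundant ℓ → Adj G ℓ s → ∃ λ t → Kept t × t ≢ ℓ × Adj G t s
  kept-sibling {ℓ} {s} red@(s′ , ℓs′ , leaf , 2≤ , _) ℓs with leaf-adj-unique leaf ℓs ℓs′
  ... | refl with another-pendant-neighbour 2≤ (ℓ ∷ []) (s≤s (s≤s z≤n))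
  ...   | t , st , leaf-t , t∉ = t , (leaf-t , ¬red-t) , t≢ℓ , adj-sym st
    where
    t≢ℓ : t ≢ ℓ
    t≢ℓ t≡ℓ = t∉ (here t≡ℓ)
    ¬red-t : ¬ Redundant t
    ¬red-t red-t = t≢ℓ (redundant-unique red-t red (adj-sym st) ℓs)

  pendantList : List (Fin n)
  pendantList = filter (isPendant? G) (allFin n)

  keptList : List (Fin n)
  keptList = filter (∁? redundant?) pendantList

  redundantList : List (Fin n)
  redundantList = filter redundant? pendantList

  ∈-keptList⁺ : ∀ {ℓ} → Kept ℓ → ℓ ∈ keptList
  ∈-keptList⁺ {ℓ} (leaf , ¬red) = ∈-filter⁺ (∁? redundant?) (∈-filter⁺ (isPendant? G) (∈-allFin ℓ) leaf) ¬red

  ∈-keptList⁻ : ∀ {ℓ} → ℓ ∈ keptList → Kept ℓ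
  ∈-keptList⁻ ℓ∈ with ∈-filter⁻ (∁? redundant?) {xs = pendantList} ℓ∈
  ... | ℓ∈P , ¬red = proj₂ (∈-filter⁻ (isPendant? G) {xs = allFin n} ℓ∈P) , ¬red

  keptList-unique : Unique keptList
  keptList-unique = Unique.filter⁺ (∁? redundant?) (Unique.filter⁺ (isPendant? G) (Unique.allFin⁺ n))

  n₁≡redundant+kept : n₁ G ≡ length redundantList + length keptList
  n₁≡redundant+kept = length-filter+length-filter-∁ redundant? pendantList

  support : Fin n → Fin n
  support x with Fin.any? (adj? x)
  ... | yes (s , _) = s
  ... | no _        = x

  support-leaf : ∀ {ℓ s} → Leaf ℓ → Adj G ℓ s → support ℓ ≡ s
  support-leaf {ℓ} leaf ℓs with Fin.any? (adj? ℓ)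
  ... | yes (_ , ℓs′) = leaf-adj-unique leaf ℓs ℓs′
  ... | no none       = ⊥-elim (none (_ , ℓs))

  ρ≤redundant : ρ G ≤ length redundantList
  ρ≤redundant = begin
    ρ G                                   ≤⟨ Unique-⊆⇒length-≤ (Unique.filter⁺ multi? (Unique.allFin⁺ n)) supported ⟩
    length (map support redundantList) ≡⟨ List.length-map support redundantList ⟩
    length redundantList                  ∎
    where
    open ≤-Reasoning
    multi? : ∀ s → Dec (2 ≤ pendantNeighbours G s)
    multi? s = 2 ≤? pendantNeighbours G s

    supported : filter multi? (allFin n) ⊆ map support redundantList
    supported {s} s∈ with another-pendant-neighbour (proj₂ (∈-filter⁻ multi? {xs = allFin n} s∈)) [] (s≤s z≤n)
    ... | ℓ₀ , sℓ₀ , leaf₀ , _ with minimiser (λ ℓ → adj? s ℓ ×-dec isPendant? G ℓ) toℕ (sℓ₀ , leaf₀)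
    ...   | ℓ , (sℓ , leaf) , least = subst (_∈ map support redundantList) (support-leaf leaf (adj-sym sℓ))
              (∈-map⁺ support (∈-filter⁺ redundant? (∈-filter⁺ (isPendant? G) (∈-allFin ℓ) leaf) red))
      where
      red : Redundant ℓ
      red = s , adj-sym sℓ , leaf , proj₂ (∈-filter⁻ multi? {xs = allFin n} s∈) ,
            λ ℓ′ sℓ′ leaf′ → least ℓ′ (sℓ′ , leaf′)

  kept≤n₁∸ρ : length keptList ≤ n₁ G ∸ ρ G
  kept≤n₁∸ρ = m+n≤o⇒m≤o∸n (length keptList) (begin
    length keptList + ρ G                    ≤⟨ +-monoʳ-≤ (length keptList) ρ≤redundant ⟩
    length keptList + length redundantList   ≡⟨ +-comm (length keptList) _ ⟩
    length redundantList + length keptList   ≡⟨ sym n₁≡redundant+kept ⟩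
    n₁ G                                     ∎)
    where open ≤-Reasoning

module Resolution {n : ℕ} (G : Graph n) (connected : Connected G)
    (cycle-unique : ∀ (C C′ : Cycle G) → SameCycle C C′)
    (cycle-degree : ∀ (C : Cycle G) v → OnCycle C v → 2 < degree G v) where
  open Neighbourhood G
  open Distance G connected
  open PendantVertices G
  open BranchingUnicyclic G connected cycle-unique cycle-degree

  SeparatedByKept : Fin n → Fin n → Set
  SeparatedByKept u v = ∃ λ ℓ → Kept ℓ × dist u ℓ ≢ dist v ℓ

  sibling-leaves-equidistant : ∀ {ℓ t s w} → Leaf ℓ → Adj G ℓ s → Leaf t → Adj G t s →
                               w ≢ ℓ → w ≢ t → dist w ℓ ≡ dist w t
  sibling-leaves-equidistant leaf-ℓ ℓs leaf-t ts w≢ℓ w≢t =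
    trans (leaf-dist leaf-ℓ ℓs w≢ℓ) (sym (leaf-dist leaf-t ts w≢t))

  separated-unless-redundant : ∀ {u v ℓ} → ¬ Kept u → ¬ Kept v → Leaf ℓ → dist u ℓ < dist v ℓ →
                               SeparatedByKept u v ⊎ (u ≡ ℓ × Redundant u)
  separated-unless-redundant {u} {v} {ℓ} ¬kept-u ¬kept-v leaf u<v with kept? ℓ
  ... | yes kept-ℓ = inj₁ (ℓ , kept-ℓ , <⇒≢ u<v)
  ... | no ¬kept-ℓ with decidable-stable (redundant? ℓ) (λ ¬red → ¬kept-ℓ (leaf , ¬red))
  ...   | red@(s , ℓs , _) with u Fin.≟ ℓ
  ...     | yes refl = inj₂ (refl , red)
  ...     | no u≢ℓ with kept-sibling red ℓs
  ...       | t , kept-t@(leaf-t , _) , _ , ts = inj₁ (t , kept-t , λ ut≡vt → <⇒≢ u<v (begin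
    dist u ℓ ≡⟨ sibling-leaves-equidistant leaf ℓs leaf-t ts u≢ℓ (λ { refl → ¬kept-u kept-t }) ⟩
    dist u t ≡⟨ ut≡vt ⟩
    dist v t ≡⟨ sibling-leaves-equidistant leaf-t ts leaf ℓs (λ { refl → ¬kept-v kept-t }) v≢ℓ ⟩
    dist v ℓ ∎))
    where
    open ≡-Reasoning
    v≢ℓ : v ≢ ℓ
    v≢ℓ refl = <⇒≱ u<v (subst (_≤ dist u v) (sym (dist-refl v)) z≤n)

  redundant-pair-separated : ∀ {u v} → u ≢ v → Redundant u → Redundant v → SeparatedByKept u v
  redundant-pair-separated {u} {v} u≢v red-u@(s₁ , us₁ , leaf-u , _) red-v@(s₂ , vs₂ , leaf-v , _)
    with kept-sibling red-u us₁
  ... | t , kept-t@(leaf-t , _) , t≢u , ts₁ =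
    t , kept-t , s₁≢s₂ ∘ dist≡0⇒≡ ∘ suc-injective ∘ suc-injective ∘ through-t
    where
    open ≡-Reasoning
    s₁≢v : s₁ ≢ v
    s₁≢v refl = t≢u (leaf-adj-unique leaf-v (adj-sym us₁) (adj-sym ts₁))
    v≢t : v ≢ t
    v≢t refl = proj₂ kept-t red-v
    s₁≢s₂ : s₁ ≢ s₂
    s₁≢s₂ refl = u≢v (redundant-unique red-u red-v us₁ vs₂)
    through-t : dist u t ≡ dist v t → suc (suc (dist s₁ s₂)) ≡ 2
    through-t ut≡vt = begin
      suc (suc (dist s₁ s₂)) ≡⟨ cong suc (sym (trans (dist-sym v s₁) (leaf-dist leaf-v vs₂ s₁≢v))) ⟩
      suc (dist v s₁)        ≡⟨ sym (leaf-dist leaf-t ts₁ v≢t) ⟩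
      dist v t               ≡⟨ sym ut≡vt ⟩
      dist u t               ≡⟨ leaf-dist leaf-t ts₁ (t≢u ∘ sym) ⟩
      suc (dist u s₁)        ≡⟨ cong suc (adj⇒dist≡1 us₁) ⟩
      2                      ∎

  non-kept-separated : ∀ {u v} → u ≢ v → ¬ Kept u → ¬ Kept v → SeparatedByKept u v
  non-kept-separated u≢v ¬kept-u ¬kept-v with far-leaf u≢v
  ... | _ , leaf , u<v with separated-unless-redundant ¬kept-u ¬kept-v leaf u<v
  ...   | inj₁ separated = separated
  ...   | inj₂ (refl , red-u) with far-leaf (u≢v ∘ sym)
  ...     | _ , leaf′ , v<u with separated-unless-redundant ¬kept-v ¬kept-u leaf′ v<u
  ...       | inj₁ (t , kept-t , vt≢ut) = t , kept-t , vt≢ut ∘ sym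
  ...       | inj₂ (refl , red-v)        = redundant-pair-separated u≢v red-u red-v

  separated : ∀ {u v} → u ≢ v → SeparatedByKept u v
  separated {u} {v} u≢v with kept? u | kept? v
  ... | yes kept-u | _          = u , kept-u , λ uu≡vu → u≢v (sym (dist≡0⇒≡ (trans (sym uu≡vu) (dist-refl u))))
  ... | no _       | yes kept-v = v , kept-v , λ uv≡vv → u≢v (dist≡0⇒≡ (trans uv≡vv (dist-refl v)))
  ... | no ¬kept-u | no ¬kept-v = non-kept-separated u≢v ¬kept-u ¬kept-v

  class : Fin n → Fin (suc (length keptList))
  class x with kept? x
  ... | yes kept-x = Fin.inject₁ (index (∈-keptList⁺ kept-x))
  ... | no _       = Fin.fromℕ (length keptList)

  class-singleton : ∀ {ℓ w} → Kept ℓ → class w ≡ class ℓ → w ≡ ℓ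
  class-singleton {ℓ} {w} kept-ℓ eq with kept? ℓ | kept? w
  ... | no ¬kept-ℓ | _          = ⊥-elim (¬kept-ℓ kept-ℓ)
  ... | yes _      | no _       = ⊥-elim (Fin.fromℕ≢inject₁ eq)
  ... | yes kℓ     | yes kw     = trans (lookup-index (∈-keptList⁺ kw))
      (trans (cong (lookup keptList) (Fin.inject₁-injective eq)) (sym (lookup-index (∈-keptList⁺ kℓ))))

  class-lookup : ∀ j → class (lookup keptList j) ≡ Fin.inject₁ j
  class-lookup j with kept? (lookup keptList j)
  ... | yes kept-x = cong Fin.inject₁ (lookup-injective keptList-unique (sym (lookup-index (∈-keptList⁺ kept-x))))
  ... | no ¬kept-x = ⊥-elim (¬kept-x (∈-keptList⁻ (∈-lookup j)))

  class-not-kept : ∀ {x} → ¬ Kept x → class x ≡ Fin.fromℕ (length keptList)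
  class-not-kept {x} ¬kept-x with kept? x
  ... | yes kept-x = ⊥-elim (¬kept-x kept-x)
  ... | no _       = refl

  dist-to-kept-class : ∀ {ℓ} → Kept ℓ → ∀ x → SetDistIs G class x (class ℓ) (dist x ℓ)
  dist-to-kept-class {ℓ} kept-ℓ x =
    (ℓ , refl , dist-DistIs x ℓ) ,
    λ w j eq d → subst (λ w → dist x w ≤ j) (class-singleton kept-ℓ eq) (dist-minimal (proj₁ d))

  resolvingPartition : (∃ λ c → ¬ Kept c) → ResolvingPartition G (suc (length keptList))
  resolvingPartition (c , ¬kept-c) = record
    { cls       = class
    ; nonempty  = λ i → case Top.view i of λ where
        Top.‵fromℕ       → c , class-not-kept ¬kept-c
        (Top.‵inject₁ j) → lookup keptList j , class-lookup j
    ; resolving = λ u v u≢v → let ℓ , kept-ℓ , ne = separated u≢v in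
        class ℓ , _ , _ , dist-to-kept-class kept-ℓ u , dist-to-kept-class kept-ℓ v , ne
    }

mainTheorem2 : ∀ (n : ℕ) (G : Graph n) → Unicyclic G →
    (∀ (C : Cycle G) (v : _) → OnCycle C v → 2 < degree G v) →
    PdAtMost G (n₁ G ∸ ρ G + 1)
mainTheorem2 n G (connected , C₀ , cycle-unique) cycle-degree =
  suc (length keptList) ,
  subst (suc (length keptList) ≤_) (+-comm 1 (n₁ G ∸ ρ G)) (s≤s kept≤n₁∸ρ) ,
  resolvingPartition (vert C₀ Fin.zero , λ (leaf , _) →
    <⇒≱ (cycle-degree C₀ _ (Fin.zero , refl)) (≤-trans (≤-reflexive leaf) (n≤1+n 1)))
  where
  open PendantVertices G
  open Resolution G connected cycle-unique cycle-degree
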